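{- Let $\ell$ be a positive integer and $S$ a string. Any two distinct maximal $\ell$-periodic substrings of $S$ overlap by fewer than $\ell/2$ letters.
   Context: A period of a string $X$ is an integer $p\in[1,|X|]$ with $X[i]=X[i+p]$ for all $i\le|X|-p$; $\mathrm{per}(X)$ is the smallest period. A string $T$ is $\ell$-periodic if $|T|\ge\ell$ and $\mathrm{per}(T)\le\ell/4$. A substring $S[i..j]$ (occurrence, i.e. given by its positions) is a maximal $\ell$-periodic substring of $S$ if it is $\ell$-periodic, and either $i=1$ or $\mathrm{per}(S[i-1..j])>\ell/4$, and either $j=|S|$ or $\mathrm{per}(S[i..j+1])>\ell/4$. -}

module Defs where

open import Level using (Level)
open import Data.Nat using (ℕ; zero; suc; _+_; _*_; _∸_; _≤_; _<_; _⊓_; _⊔_)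
open import Data.Product using (Σ; _×_; ∃)
open import Data.Sum using (_⊎_)
open import Relation.Binary.PropositionalEquality using (_≡_)

-- A string of length n over alphabet A is represented by S : ℕ → A together
-- with n; only positions 0 .. n-1 are ever inspected.  Positions are
-- 0-indexed; the substring S[i..j] (inclusive) has length suc j ∸ i.

private variable a : Level

IsPeriod : {A : Set a} → (ℕ → A) → ℕ → ℕ → ℕ → Set a
IsPeriod S i j p =
  (1 ≤ p) × (p ≤ suc j ∸ i) × (∀ k → i ≤ k → k + p ≤ j → S k ≡ S (k + p))

IsPer : {A : Set a} → (ℕ → A) → ℕ → ℕ → ℕ → Set a
IsPer S i j p = IsPeriod S i j p × (∀ q → IsPeriod S i j q → p ≤ q)

PerAtMostQuarter : {A : Set a} → (ℕ → A) → ℕ → ℕ → ℕ → Set a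
PerAtMostQuarter S ℓ i j = ∃ λ p → IsPer S i j p × (4 * p ≤ ℓ)

PerAboveQuarter : {A : Set a} → (ℕ → A) → ℕ → ℕ → ℕ → Set a
PerAboveQuarter S ℓ i j = ∃ λ p → IsPer S i j p × (ℓ < 4 * p)

Periodic : {A : Set a} → (ℕ → A) → ℕ → ℕ → ℕ → Set a
Periodic S ℓ i j = (ℓ ≤ suc j ∸ i) × PerAtMostQuarter S ℓ i j

MaxPeriodic : {A : Set a} → ℕ → (ℕ → A) → ℕ → ℕ → ℕ → Set a
MaxPeriodic n S ℓ i j =
  (i ≤ j) × (j < n) × Periodic S ℓ i j
  × ((i ≡ 0) ⊎ (∃ λ i' → (suc i' ≡ i) × PerAboveQuarter S ℓ i' j))
  × ((suc j ≡ n) ⊎ PerAboveQuarter S ℓ i (suc j))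

overlapLen : ℕ → ℕ → ℕ → ℕ → ℕ
overlapLen i₁ j₁ i₂ j₂ = suc (j₁ ⊓ j₂) ∸ (i₁ ⊔ i₂)

module Submission where

-- Suppose S[i₁..j₁] and S[i₂..j₂] are maximal ℓ-periodic with smallest periods
-- p₁, p₂ ≤ ℓ/4, and their overlap [w..m] has at least ℓ/2 positions.  Then
-- p₂ + p₁ ≤ ℓ/2, so the overlap contains a block of p₂ + p₁ positions.
--   * Transfer (a Fine–Wilf-type argument): inside S[i₂..j₂] the relation
--     "S k ≡ S (k + p₁)" is invariant under shifting k by p₂, and it holds on
--     p₂ consecutive positions of the block, so it holds throughout: p₁ is
--     also a period of S[i₂..j₂].
-- These two facts contradict the distinctness of the substrings.

open import Defs
open import Level using (Level)
open import Data.Nat using (ℕ; zero; suc; _+_; _*_; _∸_; _≤_; _<_; _⊓_; _⊔_; s≤s; _≤?_; _<?_)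
open import Data.Nat.Properties
open import Data.Nat.Induction using (<-rec)
open import Algebra.Properties.CommutativeSemigroup +-commutativeSemigroup using (xy∙z≈xz∙y)
open import Data.Product using (_×_; _,_; ∃)
open import Data.Sum using (_⊎_; inj₁; inj₂)
open import Data.Empty using (⊥-elim)
open import Relation.Nullary using (¬_; yes; no; contradiction)
open import Relation.Binary.Definitions using (tri<; tri≈; tri>)
open import Relation.Binary.PropositionalEquality
  using (_≡_; refl; sym; trans; cong; subst; module ≡-Reasoning)

spread : ∀ {a} (P : ℕ → Set a) {lo hi q w : ℕ} → 1 ≤ q → lo ≤ w → w + q ≤ suc hi
  → (∀ k → lo ≤ k → k + q ≤ hi → P k → P (k + q))
  → (∀ k → lo ≤ k → k + q ≤ hi → P (k + q) → P k)
  → (∀ k → w ≤ k → k < w + q → P k)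
  → ∀ k → lo ≤ k → k ≤ hi → P k
spread P {lo} {hi} {q} {w} q≥1 lo≤w w+q≤1+hi shift-up shift-down window k lo≤k k≤hi =
  below w k (m≤n+m w k) lo≤k k≤hi
  where
    above : ∀ k → w ≤ k → k ≤ hi → P k
    above = <-rec (λ k → w ≤ k → k ≤ hi → P k) step
      where
        step : ∀ k → (∀ {k'} → k' < k → w ≤ k' → k' ≤ hi → P k') → w ≤ k → k ≤ hi → P k
        step k rec w≤k k≤hi with k <? w + q
        ... | yes k<w+q = window k w≤k k<w+q
        ... | no k≮w+q = subst P k'+q≡k
                (shift-up k' (≤-trans lo≤w w≤k') (subst (_≤ hi) (sym k'+q≡k) k≤hi)
                  (rec k'<k w≤k' (≤-trans (<⇒≤ k'<k) k≤hi)))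
          where
            w+q≤k : w + q ≤ k
            w+q≤k = ≮⇒≥ k≮w+q
            q≤k : q ≤ k
            q≤k = ≤-trans (m≤n+m q w) w+q≤k
            k' : ℕ
            k' = k ∸ q
            k'+q≡k : k' + q ≡ k
            k'+q≡k = m∸n+n≡m q≤k
            w≤k' : w ≤ k'
            w≤k' = m+n≤o⇒m≤o∸n w w+q≤k
            k'<k : k' < k
            k'<k = ∸-monoʳ-< q≥1 q≤k

    -- Positions before the window, stepping forward by q; the fuel d
    -- guarantees w ≤ k + d, i.e. the window is reached after ≤ d steps.
    below : ∀ d k → w ≤ k + d → lo ≤ k → k ≤ hi → P k
    below d k w≤k+d lo≤k k≤hi with w ≤? k
    ... | yes w≤k = above k w≤k k≤hi
    below zero k w≤k+0 _ _ | no w≰k = contradiction (subst (w ≤_) (+-identityʳ k) w≤k+0) w≰k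
    below (suc d) k w≤k+1+d lo≤k _ | no w≰k =
      shift-down k lo≤k k+q≤hi (below d (k + q) w≤k+q+d (≤-trans lo≤k (m≤m+n k q)) k+q≤hi)
      where
        k+q≤hi : k + q ≤ hi
        k+q≤hi = ≤-pred (≤-trans (+-monoˡ-< q (≰⇒> w≰k)) w+q≤1+hi)
        w≤k+q+d : w ≤ k + q + d
        w≤k+q+d = ≤-trans w≤k+1+d
          (≤-trans (+-monoʳ-≤ k (+-monoˡ-≤ d q≥1)) (≤-reflexive (sym (+-assoc k q d))))

fits-in : ∀ {ℓ p len} → 4 * p ≤ ℓ → ℓ ≤ len → p ≤ len
fits-in {p = p} 4p≤ℓ ℓ≤len = ≤-trans (≤-trans (m≤n*m p 4) 4p≤ℓ) ℓ≤len

PeriodOn : ∀ {a} {A : Set a} → (ℕ → A) → ℕ → ℕ → ℕ → Set a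
PeriodOn S i j p = ∀ k → i ≤ k → k + p ≤ j → S k ≡ S (k + p)

module _ {a : Level} {A : Set a} (S : ℕ → A) where

  module ShiftInvariance {i j p q} (perq : PeriodOn S i j q) {k} (i≤k : i ≤ k)
                         (k+q+p≤j : k + q + p ≤ j) where

    agree-at-k : S k ≡ S (k + q)
    agree-at-k = perq k i≤k (≤-trans (m≤m+n (k + q) p) k+q+p≤j)

    agree-at-k+p : S (k + p) ≡ S (k + q + p)
    agree-at-k+p = begin
      S (k + p)      ≡⟨ perq (k + p) (≤-trans i≤k (m≤m+n k p))
                              (subst (_≤ j) (xy∙z≈xz∙y k q p) k+q+p≤j) ⟩
      S (k + p + q)  ≡⟨ cong S (xy∙z≈xz∙y k p q) ⟩
      S (k + q + p)  ∎
      where open ≡-Reasoning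

    up : S k ≡ S (k + p) → S (k + q) ≡ S (k + q + p)
    up e = trans (sym agree-at-k) (trans e agree-at-k+p)

    down : S (k + q) ≡ S (k + q + p) → S k ≡ S (k + p)
    down e = trans agree-at-k (trans e (sym agree-at-k+p))

  transfer : ∀ {i₁ j₁ i₂ j₂ p q w} → PeriodOn S i₁ j₁ p → PeriodOn S i₂ j₂ q → 1 ≤ q
    → i₁ ≤ w → i₂ ≤ w → w + q + p ≤ suc j₁ → w + q + p ≤ suc j₂ → PeriodOn S i₂ j₂ p
  transfer {i₁} {j₁} {i₂} {j₂} {p} {q} {w} perp perq q≥1 i₁≤w i₂≤w block₁ block₂ k i₂≤k k+p≤j₂ =
    spread (λ k → S k ≡ S (k + p)) q≥1 i₂≤w window-fits
      (λ k i₂≤k bound → ShiftInvariance.up perq i₂≤k (restore bound))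
      (λ k i₂≤k bound → ShiftInvariance.down perq i₂≤k (restore bound))
      window k i₂≤k (m+n≤o⇒m≤o∸n k k+p≤j₂)
    where
      p≤j₂ : p ≤ j₂
      p≤j₂ = ≤-pred (≤-trans (+-monoˡ-≤ p (≤-trans q≥1 (m≤n+m q w))) block₂)

      restore : ∀ {k} → k + q ≤ j₂ ∸ p → k + q + p ≤ j₂
      restore {k} = m≤o∸n⇒m+n≤o (k + q) p≤j₂

      window-fits : w + q ≤ suc (j₂ ∸ p)
      window-fits = subst (w + q ≤_) (+-∸-assoc 1 p≤j₂) (m+n≤o⇒m≤o∸n (w + q) block₂)

      window : ∀ k → w ≤ k → k < w + q → S k ≡ S (k + p)
      window k w≤k k<w+q =
        perp k (≤-trans i₁≤w w≤k) (≤-pred (≤-trans (+-monoˡ-< p k<w+q) block₁))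

  restrict : ∀ {i j i' j' p} → PeriodOn S i j p → i ≤ i' → j' ≤ j → PeriodOn S i' j' p
  restrict per i≤i' j'≤j k i'≤k k+p≤j' = per k (≤-trans i≤i' i'≤k) (≤-trans k+p≤j' j'≤j)

  extend-left : ∀ {iA jA i j p} → PeriodOn S iA jA p → PeriodOn S (suc i) j p
    → iA ≤ i → i + p ≤ jA → PeriodOn S i j p
  extend-left perA perB iA≤i i+p≤jA k i≤k k+p≤j with m≤n⇒m<n∨m≡n i≤k
  ... | inj₁ i<k = perB k i<k k+p≤j
  ... | inj₂ refl = perA k iA≤i i+p≤jA

  short-period-refutes : ∀ {ℓ i j p} → 1 ≤ p → p ≤ suc j ∸ i → PeriodOn S i j p → 4 * p ≤ ℓ
    → ¬ PerAboveQuarter S ℓ i j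
  short-period-refutes p≥1 p≤len per 4p≤ℓ (_ , (_ , minimal) , ℓ<4p') =
    <⇒≱ ℓ<4p' (≤-trans (*-monoʳ-≤ 4 (minimal _ (p≥1 , p≤len , per))) 4p≤ℓ)

  LeftMaximal : ℕ → ℕ → ℕ → Set a
  LeftMaximal ℓ i j = (i ≡ 0) ⊎ (∃ λ i' → (suc i' ≡ i) × PerAboveQuarter S ℓ i' j)

  RightMaximal : ℕ → ℕ → ℕ → ℕ → Set a
  RightMaximal n ℓ i j = (suc j ≡ n) ⊎ PerAboveQuarter S ℓ i (suc j)

  not-left-maximal : ∀ {ℓ iA jA iB jB p} → PeriodOn S iA jA p → PeriodOn S iB jB p
    → 1 ≤ p → 4 * p ≤ ℓ → p ≤ suc jB ∸ iB → iA < iB → iB + p ≤ suc jA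
    → ¬ LeftMaximal ℓ iB jB
  not-left-maximal _ _ _ _ _ () _ (inj₁ refl)
  not-left-maximal {jB = jB} perA perB p≥1 4p≤ℓ p≤len iA<iB shared (inj₂ (i , refl , per>)) =
    short-period-refutes p≥1 (≤-trans p≤len (∸-monoʳ-≤ (suc jB) (n≤1+n i)))
      (extend-left perA perB (≤-pred iA<iB) (≤-pred shared)) 4p≤ℓ per>

  not-right-maximal : ∀ {n ℓ iA jA iB jB p} → PeriodOn S iB jB p
    → 1 ≤ p → 4 * p ≤ ℓ → p ≤ suc jA ∸ iA → iB ≤ iA → jA < jB → jB < n
    → ¬ RightMaximal n ℓ iA jA
  not-right-maximal _ _ _ _ _ jA<jB jB<n (inj₁ refl) = <⇒≱ jB<n jA<jB
  not-right-maximal {iA = iA} {jA} perB p≥1 4p≤ℓ p≤len iB≤iA jA<jB _ (inj₂ per>) =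
    short-period-refutes p≥1 (≤-trans p≤len (∸-monoˡ-≤ iA (n≤1+n (suc jA))))
      (restrict perB iB≤iA jA<jB) 4p≤ℓ per>

  coincide : ∀ {n ℓ i₁ j₁ i₂ j₂ p} → MaxPeriodic n S ℓ i₁ j₁ → MaxPeriodic n S ℓ i₂ j₂
    → PeriodOn S i₁ j₁ p → PeriodOn S i₂ j₂ p → 1 ≤ p → 4 * p ≤ ℓ
    → i₂ + p ≤ suc j₁ → i₁ + p ≤ suc j₂ → (i₁ ≡ i₂) × (j₁ ≡ j₂)
  coincide {i₁ = i₁} {j₁} {i₂} {j₂}
    (_ , j₁<n , (len₁ , _) , left₁ , right₁) (_ , j₂<n , (len₂ , _) , left₂ , right₂)
    per₁ per₂ p≥1 4p≤ℓ shared₁ shared₂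
    with <-cmp i₁ i₂ | <-cmp j₁ j₂
  ... | tri< i₁<i₂ _ _ | _ =
    ⊥-elim (not-left-maximal per₁ per₂ p≥1 4p≤ℓ (fits-in 4p≤ℓ len₂) i₁<i₂ shared₁ left₂)
  ... | tri> _ _ i₂<i₁ | _ =
    ⊥-elim (not-left-maximal per₂ per₁ p≥1 4p≤ℓ (fits-in 4p≤ℓ len₁) i₂<i₁ shared₂ left₁)
  ... | tri≈ _ refl _ | tri< j₁<j₂ _ _ =
    ⊥-elim (not-right-maximal per₂ p≥1 4p≤ℓ (fits-in 4p≤ℓ len₁) ≤-refl j₁<j₂ j₂<n right₁)
  ... | tri≈ _ refl _ | tri> _ _ j₂<j₁ =
    ⊥-elim (not-right-maximal per₁ p≥1 4p≤ℓ (fits-in 4p≤ℓ len₂) ≤-refl j₂<j₁ j₁<n right₂)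
  ... | tri≈ _ refl _ | tri≈ _ refl _ = refl , refl

two-quarters-fit : ∀ {ℓ p q w m} → 1 ≤ ℓ → 4 * p ≤ ℓ → 4 * q ≤ ℓ
  → ℓ ≤ 2 * (suc m ∸ w) → w + q + p ≤ suc m
two-quarters-fit {ℓ} {p} {q} {w} {m} ℓ≥1 4p≤ℓ 4q≤ℓ ℓ≤2len = begin
  w + q + p          ≡⟨ +-assoc w q p ⟩
  w + (q + p)        ≤⟨ +-monoʳ-≤ w q+p≤len ⟩
  w + (suc m ∸ w)    ≡⟨ m+[n∸m]≡n w≤1+m ⟩
  suc m              ∎
  where
    open ≤-Reasoning
    len : ℕ
    len = suc m ∸ w

    q+p≤len : q + p ≤ len
    q+p≤len = *-cancelˡ-≤ 4 (begin
      4 * (q + p)        ≡⟨ *-distribˡ-+ 4 q p ⟩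
      4 * q + 4 * p      ≤⟨ +-mono-≤ (≤-trans 4q≤ℓ ℓ≤2len) (≤-trans 4p≤ℓ ℓ≤2len) ⟩
      2 * len + 2 * len  ≡⟨ *-distribʳ-+ len 2 2 ⟨
      4 * len            ∎)

    w≤1+m : w ≤ suc m
    w≤1+m with w ≤? suc m
    ... | yes w≤1+m = w≤1+m
    ... | no w≰1+m = contradiction (≤-trans ℓ≥1 (subst (λ x → ℓ ≤ 2 * x) empty ℓ≤2len)) (λ ())
      where
        empty : len ≡ 0
        empty = m≤n⇒m∸n≡0 (<⇒≤ (≰⇒> w≰1+m))

lemma9 : ∀ {a : Level} {A : Set a} (ℓ : ℕ) → 1 ≤ ℓ
    → (n : ℕ) (S : ℕ → A) (i₁ j₁ i₂ j₂ : ℕ)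
    → MaxPeriodic n S ℓ i₁ j₁ → MaxPeriodic n S ℓ i₂ j₂
    → ¬ ((i₁ ≡ i₂) × (j₁ ≡ j₂))
    → 2 * overlapLen i₁ j₁ i₂ j₂ < ℓ
lemma9 ℓ ℓ≥1 n S i₁ j₁ i₂ j₂
  max₁@(_ , _ , (_ , p₁ , ((p₁≥1 , _ , per₁) , _) , 4p₁≤ℓ) , _)
  max₂@(_ , _ , (_ , p₂ , ((p₂≥1 , _ , per₂) , _) , 4p₂≤ℓ) , _) distinct
  with 2 * overlapLen i₁ j₁ i₂ j₂ <? ℓ
... | yes short = short
... | no long = ⊥-elim (distinct
        (coincide S max₁ max₂ per₁ per₁-on₂ p₁≥1 4p₁≤ℓ
          (shared-from-block i₂≤w block₁) (shared-from-block i₁≤w block₂)))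
  where
    w : ℕ
    w = i₁ ⊔ i₂
    i₁≤w : i₁ ≤ w
    i₁≤w = m≤m⊔n i₁ i₂
    i₂≤w : i₂ ≤ w
    i₂≤w = m≤n⊔m i₁ i₂

    block : w + p₂ + p₁ ≤ suc (j₁ ⊓ j₂)
    block = two-quarters-fit {p = p₁} {p₂} {w} ℓ≥1 4p₁≤ℓ 4p₂≤ℓ (≮⇒≥ long)
    block₁ : w + p₂ + p₁ ≤ suc j₁
    block₁ = ≤-trans block (s≤s (m⊓n≤m j₁ j₂))
    block₂ : w + p₂ + p₁ ≤ suc j₂
    block₂ = ≤-trans block (s≤s (m⊓n≤n j₁ j₂))

    per₁-on₂ : PeriodOn S i₂ j₂ p₁
    per₁-on₂ = transfer S per₁ per₂ p₂≥1 i₁≤w i₂≤w block₁ block₂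

    shared-from-block : ∀ {i j} → i ≤ w → w + p₂ + p₁ ≤ suc j → i + p₁ ≤ suc j
    shared-from-block i≤w fits = ≤-trans (+-mono-≤ i≤w (m≤n+m p₁ p₂))
                                 (≤-trans (≤-reflexive (sym (+-assoc w p₂ p₁))) fits)
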